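{- Let $D$ be a locatable digraph of order $n$ with $\gamma_{OL}(D)=n$. Let $x$ be an arbitrary vertex of $D$ and let $D'$ be the digraph obtained from $D$ by deleting all non-forcing arcs of $D$ whose tail is $x$. Then $D'$ is locatable and $\gamma_{OL}(D')=n$. Moreover, if $x$ is not location-forced in $D$, then $D$ and $D'$ have the same sets of forcing arcs.
   Context: Digraphs are finite and may contain loops; for each ordered pair $(x,y)$ there is at most one arc $xy$. $N^-(v)$ is the set of vertices $u$ such that $uv$ is an arc (including $v$ if $v$ has a loop). An OLD set of $D$ is a set $S\subseteq V(D)$ such that every vertex has an in-neighbour in $S$ and for every two distinct vertices $u,v$, some vertex of $S$ lies in $N^-(u)\ominus N^-(v)$ (symmetric difference). $D$ is locatable if it admits an OLD set; $\gamma_{OL}(D)$ is the minimum size of an OLD set. A vertex $v$ is location-forced if there are distinct vertices $y,z$ with $N^-(y)\ominus N^-(z)=\{v\}$. An arc $xy$ of $D$ is a forcing arc if either $N^-(y)=\{x\}$, or there is a vertex $z$ with $N^-(y)\ominus N^-(z)=\{x\}$ (i.e. $x\in N^-(y)$ and $N^-(z)=N^-(y)\setminus\{x\}$). -}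

module Defs where

open import Data.Nat using (ℕ; _≤_)
open import Data.Fin using (Fin)
open import Data.Fin.Subset using (Subset; _∈_; ∣_∣)
open import Data.Product using (Σ; _×_; ∃; ∃-syntax)
open import Data.Sum using (_⊎_)
open import Relation.Nullary using (¬_)
open import Relation.Binary.PropositionalEquality using (_≡_; _≢_)
open import Function.Bundles using (_⇔_)

-- A digraph of order n: vertex set Fin n, arc relation Arc u v = "uv is an arc".
-- Loops allowed (Arc v v); at most one arc per ordered pair is automatic.
Digraph : ℕ → Set₁
Digraph n = Fin n → Fin n → Set

module _ {n : ℕ} (D : Digraph n) where

  InSymDiff : Fin n → Fin n → Fin n → Set
  InSymDiff u v w = (D w u × ¬ D w v) ⊎ (D w v × ¬ D w u)

  SymDiffSingleton : Fin n → Fin n → Fin n → Set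
  SymDiffSingleton u v x = ∀ w → InSymDiff u v w ⇔ (w ≡ x)

  IsOLD : Subset n → Set
  IsOLD S = (∀ v → ∃[ u ] (u ∈ S × D u v))
          × (∀ u v → u ≢ v → ∃[ w ] (w ∈ S × InSymDiff u v w))

  Locatable : Set
  Locatable = ∃[ S ] IsOLD S

  γOL≡ : ℕ → Set
  γOL≡ k = (∃[ S ] (IsOLD S × ∣ S ∣ ≡ k)) × (∀ S → IsOLD S → k ≤ ∣ S ∣)

  LocationForced : Fin n → Set
  LocationForced v = ∃[ y ] ∃[ z ] (y ≢ z × SymDiffSingleton y z v)

  ForcingArc : Fin n → Fin n → Set
  ForcingArc x y = D x y × ((∀ w → D w y ⇔ (w ≡ x)) ⊎ (∃[ z ] SymDiffSingleton y z x))

deleteNonForcingFrom : {n : ℕ} → Digraph n → Fin n → Digraph n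
deleteNonForcingFrom D x u v = D u v × (u ≡ x → ForcingArc D u v)

{-# OPTIONS --safe #-}
module Submission where

-- If γ_OL(D) = n, no vertex p can be dropped from the OLD set V(D), and this forces p: either
-- N⁻(y) = {p} for some y, or p is location-forced. Forced vertices lie in every OLD set.
-- Deleting the non-forcing arcs out of x keeps V(D) an OLD set and keeps every vertex forced,
-- so γ_OL(D′) = n as well.
--
-- For the forcing arcs, the only delicate case is an arc uv that is forcing in D′ via some z
-- while N⁻(v) ⊖ N⁻(z) = {u, x} in D. Read in-neighbourhoods as vectors over GF(2): since every
-- vertex is forced, every unit vector is a sum of at most two of them, so the n in-neighbourhoods
-- span GF(2)^n and are therefore linearly independent. As x is forced but not location-forced,
-- N⁻(y₀) = {x} for some y₀; writing {u} as N⁻(a) or as N⁻(a) ⊖ N⁻(b), independence and a parity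
-- count leave only N⁻(v) = {u}.

open import Defs
open import Algebra.Bundles using (CommutativeRing; CommutativeMonoid)
open import Data.Bool using (Bool; true; false; _xor_; if_then_else_)
open import Data.Bool.Properties using (xor-identityˡ; xor-identityʳ; xor-same; xor-∧-commutativeRing)
open import Algebra.Properties.CommutativeSemigroup
  (CommutativeMonoid.commutativeSemigroup (CommutativeRing.+-commutativeMonoid xor-∧-commutativeRing))
  using () renaming (interchange to xor-interchange)
open import Data.Empty using (⊥-elim)
open import Data.Fin using (Fin; zero; suc; _≟_; punchOut)
open import Data.Fin.Properties using (all?; any?; suc-injective; injective⇒≤; punchOut-injective; 2↔Bool; *↔×)
open import Data.Fin.Subset using (_∈_; _⊆_; ⊤; ∁; ⁅_⁆; ∣_∣) renaming (⊥ to ∅)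
open import Data.Fin.Subset.Properties using (∈⊤; ⊆⊤; ∣⊤∣≡n; x∈⁅x⁆; x∈⁅y⁆⇒x≡y; x∈∁p⇒x∉p; x∉p⇒x∈∁p; p⊆q⇒∣p∣≤∣q∣; p⊂q⇒∣p∣<∣q∣)
open import Data.Nat using (ℕ; zero; suc; _^_; _≤_; _<_)
open import Data.Nat.Properties using (1+n≰n; <⇒≱)
open import Data.Product using (_×_; _,_; ∃; ∃-syntax; proj₁; proj₂; uncurry)
open import Data.Product.Function.NonDependent.Propositional using (_×-↔_)
open import Data.Sum using (_⊎_; inj₁; inj₂)
open import Data.Vec using (Vec; []; _∷_; zipWith; tabulate; lookup; uncons)
open import Data.Vec.Properties using (zipWith-identityˡ; zipWith-identityʳ; tabulate-cong; tabulate∘lookup; lookup-replicate; lookup-zipWith)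
open import Function using (_∘_; Injective)
open import Function.Bundles using (_⇔_; mk⇔; Equivalence; _↔_; mk↔ₛ′; Inverse)
open import Function.Properties.Inverse using (↔-sym; ↔-trans)
open import Function.Construct.Identity using (⇔-id)
open import Function.Construct.Symmetry using (⇔-sym)
open import Function.Construct.Composition using (_⇔-∘_)
open import Relation.Nullary using (Dec; does; yes; no; ¬_; contradiction)
open import Relation.Nullary.Decidable using (decidable-stable; dec-true; dec-false; _×-dec_; _⊎-dec_; ¬?)
open import Relation.Binary.PropositionalEquality

private
  variable
    m n N : ℕ
    A B A′ B′ : Set

open Equivalence using (to; from)

infix 5 _⊖_
_⊖_ : Set → Set → Set
A ⊖ B = (A × ¬ B) ⊎ (B × ¬ A)

⊖-comm : A ⊖ B → B ⊖ A
⊖-comm (inj₁ p) = inj₂ p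
⊖-comm (inj₂ p) = inj₁ p

⊖-cong : A ⇔ A′ → B ⇔ B′ → A ⊖ B ⇔ A′ ⊖ B′
⊖-cong f g = mk⇔ (transport f g) (transport (⇔-sym f) (⇔-sym g))
  where
  transport : ∀ {C C′ E E′ : Set} → C ⇔ C′ → E ⇔ E′ → C ⊖ E → C′ ⊖ E′
  transport h k (inj₁ (c , ¬e)) = inj₁ (to h c , ¬e ∘ from k)
  transport h k (inj₂ (e , ¬c)) = inj₂ (to k e , ¬c ∘ from h)

⇔⇒¬⊖ : A ⇔ B → ¬ (A ⊖ B)
⇔⇒¬⊖ f (inj₁ (a , ¬b)) = ¬b (to f a)
⇔⇒¬⊖ f (inj₂ (b , ¬a)) = ¬a (from f b)

infix 5 _⊖?_
_⊖?_ : Dec A → Dec B → Dec (A ⊖ B)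
a? ⊖? b? = (a? ×-dec ¬? b?) ⊎-dec (b? ×-dec ¬? a?)

does-⊖ : (a? : Dec A) (b? : Dec B) → does (a? ⊖? b?) ≡ does a? xor does b?
does-⊖ (yes _) (yes _) = refl
does-⊖ (yes _) (no _)  = refl
does-⊖ (no _)  (yes _) = refl
does-⊖ (no _)  (no _)  = refl

does-cong : A ⇔ B → (a? : Dec A) (b? : Dec B) → does a? ≡ does b?
does-cong _ (yes _) (yes _) = refl
does-cong f (yes a) (no ¬b) = contradiction (to f a) ¬b
does-cong f (no ¬a) (yes b) = contradiction (from f b) ¬a
does-cong _ (no _)  (no _)  = refl

does≡true⇒ : (a? : Dec A) → does a? ≡ true → A
does≡true⇒ (yes a) _ = a

¬⇒⇔ : ¬ A → ¬ B → A ⇔ B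
¬⇒⇔ ¬a ¬b = mk⇔ (⊥-elim ∘ ¬a) (⊥-elim ∘ ¬b)

infix 4 _⇔?_
_⇔?_ : Dec A → Dec B → Dec (A ⇔ B)
yes a ⇔? yes b = yes (mk⇔ (λ _ → b) (λ _ → a))
yes a ⇔? no ¬b = no (λ f → ¬b (to f a))
no ¬a ⇔? yes b = no (λ f → ¬a (from f b))
no ¬a ⇔? no ¬b = yes (¬⇒⇔ ¬a ¬b)

injective⇒surjective : {f : Fin N → Fin N} → Injective _≡_ _≡_ f → ∀ k → ∃ λ i → f i ≡ k
injective⇒surjective {suc N} {f} f-injective k with any? (λ i → f i ≟ k)
... | yes hit = hit
... | no  miss = contradiction (injective⇒≤ punched-injective) 1+n≰n
  where
  k≢f : ∀ i → k ≢ f i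
  k≢f i k≡fi = miss (i , sym k≡fi)
  punched : Fin (suc N) → Fin N
  punched i = punchOut (k≢f i)
  punched-injective : Injective _≡_ _≡_ punched
  punched-injective = f-injective ∘ punchOut-injective (k≢f _) (k≢f _)

∷↔× : Vec A (suc n) ↔ (A × Vec A n)
∷↔× = mk↔ₛ′ uncons (uncurry _∷_) (λ _ → refl) (λ { (_ ∷ _) → refl })

Vec-Bool↔Fin : ∀ n → Vec Bool n ↔ Fin (2 ^ n)
Vec-Bool↔Fin zero    = mk↔ₛ′ (λ _ → zero) (λ _ → []) (λ { zero → refl }) (λ { [] → refl })
Vec-Bool↔Fin (suc n) = ↔-trans ∷↔× (↔-trans (↔-sym 2↔Bool ×-↔ Vec-Bool↔Fin n) (↔-sym *↔×))

leftInverse⇒injective : {f : B → A} {g : A → B} → (∀ a → f (g a) ≡ a) → Injective _≡_ _≡_ g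
leftInverse⇒injective {f = f} f∘g≗id {a} {b} ga≡gb = trans (sym (f∘g≗id a)) (trans (cong f ga≡gb) (f∘g≗id b))

module _ (A↔Fin : A ↔ Fin N) where
  open Inverse A↔Fin using () renaming (to to encode; from to decode; strictlyInverseˡ to encode∘decode; strictlyInverseʳ to decode∘encode)

  private
    encode-injective : Injective _≡_ _≡_ encode
    encode-injective = leftInverse⇒injective {f = decode} decode∘encode

    decode-injective : Injective _≡_ _≡_ decode
    decode-injective = leftInverse⇒injective {f = encode} encode∘decode

  finite-injective⇒surjective : {g : A → A} → Injective _≡_ _≡_ g → ∀ a → ∃ λ b → g b ≡ a
  finite-injective⇒surjective {g} g-injective a
    with i , h≡ ← injective⇒surjective {f = encode ∘ g ∘ decode} (decode-injective ∘ g-injective ∘ encode-injective) (encode a)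
    = decode i , encode-injective h≡

  finite-leftInverse⇒rightInverse : {f g : A → A} → (∀ a → f (g a) ≡ a) → ∀ a → g (f a) ≡ a
  finite-leftInverse⇒rightInverse {f} {g} f∘g≗id a
    with b , refl ← finite-injective⇒surjective (leftInverse⇒injective {f = f} {g} f∘g≗id) a
    = cong g (f∘g≗id b)

other-or-only : {P : Fin n → Set} → (∀ i → Dec (P i)) → ∃ P → ∀ x →
                (∃ λ w → w ≢ x × P w) ⊎ (∀ w → P w ⇔ (w ≡ x))
other-or-only {P = P} P? (w₀ , Pw₀) x with any? (λ w → ¬? (w ≟ x) ×-dec P? w)
... | yes other = inj₁ other
... | no  none  = inj₂ λ w → mk⇔ (only w) (λ { refl → subst P (only w₀ Pw₀) Pw₀ })
  where
  only : ∀ w → P w → w ≡ x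
  only w Pw = decidable-stable (w ≟ x) (λ w≢x → none (w , w≢x , Pw))

-- Vectors over GF(2)
-- (Subset n is Vec Bool n, so ⁅ p ⁆ is the p-th unit vector and ∅ the zero vector.)

infixl 6 _⊕_
_⊕_ : Vec Bool n → Vec Bool n → Vec Bool n
_⊕_ = zipWith _xor_

⊕-identityˡ : ∀ (a : Vec Bool n) → ∅ ⊕ a ≡ a
⊕-identityˡ = zipWith-identityˡ xor-identityˡ

⊕-identityʳ : ∀ (a : Vec Bool n) → a ⊕ ∅ ≡ a
⊕-identityʳ = zipWith-identityʳ xor-identityʳ

⊕-self : ∀ (a : Vec Bool n) → a ⊕ a ≡ ∅
⊕-self []       = refl
⊕-self (a ∷ as) = cong₂ _∷_ (xor-same a) (⊕-self as)

⊕-interchange : ∀ (a b c d : Vec Bool n) → (a ⊕ b) ⊕ (c ⊕ d) ≡ (a ⊕ c) ⊕ (b ⊕ d)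
⊕-interchange []       []       []       []       = refl
⊕-interchange (a ∷ as) (b ∷ bs) (c ∷ cs) (d ∷ ds) =
  cong₂ _∷_ (xor-interchange a b c d) (⊕-interchange as bs cs ds)

indicator : {P : Fin n → Set} → (∀ i → Dec (P i)) → Vec Bool n
indicator P? = tabulate (does ∘ P?)

indicator-cong : {P Q : Fin n → Set} (P? : ∀ i → Dec (P i)) (Q? : ∀ i → Dec (Q i)) →
                 (∀ i → P i ⇔ Q i) → indicator P? ≡ indicator Q?
indicator-cong P? Q? P⇔Q = tabulate-cong (λ i → does-cong (P⇔Q i) (P? i) (Q? i))

indicator-⊕ : {P Q : Fin n → Set} (P? : ∀ i → Dec (P i)) (Q? : ∀ i → Dec (Q i)) →
              indicator P? ⊕ indicator Q? ≡ indicator (λ i → P? i ⊖? Q? i)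
indicator-⊕ {zero}  P? Q? = refl
indicator-⊕ {suc n} P? Q? =
  cong₂ _∷_ (sym (does-⊖ (P? zero) (Q? zero))) (indicator-⊕ (P? ∘ suc) (Q? ∘ suc))

lookup-⁅⁆ : ∀ (p i : Fin n) → lookup ⁅ p ⁆ i ≡ does (i ≟ p)
lookup-⁅⁆ zero    zero    = refl
lookup-⁅⁆ zero    (suc i) = lookup-replicate i false
lookup-⁅⁆ (suc p) zero    = refl
lookup-⁅⁆ (suc p) (suc i) = trans (lookup-⁅⁆ p i) (does-cong (mk⇔ (cong suc) suc-injective) (i ≟ p) (suc i ≟ suc p))

lookup-⁅⁆-self : ∀ (p : Fin n) → lookup ⁅ p ⁆ p ≡ true
lookup-⁅⁆-self p = trans (lookup-⁅⁆ p p) (dec-true (p ≟ p) refl)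

lookup-⁅⁆-other : ∀ (p i : Fin n) → p ≢ i → lookup ⁅ p ⁆ i ≡ false
lookup-⁅⁆-other p i p≢i = trans (lookup-⁅⁆ p i) (dec-false (i ≟ p) (p≢i ∘ sym))

⁅⁆-indicator : ∀ (p : Fin n) → ⁅ p ⁆ ≡ indicator (_≟ p)
⁅⁆-indicator p = trans (sym (tabulate∘lookup ⁅ p ⁆)) (tabulate-cong (lookup-⁅⁆ p))

scale : Bool → Vec Bool n → Vec Bool n
scale c v = if c then v else ∅

scale-xor : ∀ c d (v : Vec Bool n) → scale (c xor d) v ≡ scale c v ⊕ scale d v
scale-xor true  true  v = sym (⊕-self v)
scale-xor true  false v = sym (⊕-identityʳ v)
scale-xor false true  v = sym (⊕-identityˡ v)
scale-xor false false v = sym (⊕-identityˡ ∅)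

combination : Vec Bool m → (Fin m → Vec Bool n) → Vec Bool n
combination []       w = ∅
combination (c ∷ cs) w = scale c (w zero) ⊕ combination cs (w ∘ suc)

combination-∅ : ∀ (w : Fin m → Vec Bool n) → combination ∅ w ≡ ∅
combination-∅ {zero}  w = refl
combination-∅ {suc m} w = trans (⊕-identityˡ _) (combination-∅ (w ∘ suc))

combination-⁅⁆ : ∀ (j : Fin m) (w : Fin m → Vec Bool n) → combination ⁅ j ⁆ w ≡ w j
combination-⁅⁆ zero    w = trans (cong (w zero ⊕_) (combination-∅ (w ∘ suc))) (⊕-identityʳ (w zero))
combination-⁅⁆ (suc j) w = trans (⊕-identityˡ _) (combination-⁅⁆ j (w ∘ suc))

combination-⊕ : ∀ (s t : Vec Bool m) (w : Fin m → Vec Bool n) →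
                combination (s ⊕ t) w ≡ combination s w ⊕ combination t w
combination-⊕ []       []       w = sym (⊕-identityˡ ∅)
combination-⊕ (c ∷ cs) (d ∷ ds) w = begin
  scale (c xor d) (w zero) ⊕ combination (cs ⊕ ds) (w ∘ suc)
    ≡⟨ cong₂ _⊕_ (scale-xor c d (w zero)) (combination-⊕ cs ds (w ∘ suc)) ⟩
  (scale c (w zero) ⊕ scale d (w zero)) ⊕ (combination cs (w ∘ suc) ⊕ combination ds (w ∘ suc))
    ≡⟨ ⊕-interchange _ _ _ _ ⟩
  combination (c ∷ cs) w ⊕ combination (d ∷ ds) w ∎
  where open ≡-Reasoning

combination-cong : ∀ (s : Vec Bool m) {w w′ : Fin m → Vec Bool n} → (∀ i → w i ≡ w′ i) →
                   combination s w ≡ combination s w′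
combination-cong []       w≗w′ = refl
combination-cong (c ∷ cs) w≗w′ = cong₂ _⊕_ (cong (scale c) (w≗w′ zero)) (combination-cong cs (w≗w′ ∘ suc))

additive-combination : {f : Vec Bool n → Vec Bool m} → f ∅ ≡ ∅ → (∀ a b → f (a ⊕ b) ≡ f a ⊕ f b) →
                       ∀ (s : Vec Bool N) w → f (combination s w) ≡ combination s (f ∘ w)
additive-combination f∅ f⊕ []           w = f∅
additive-combination f∅ f⊕ (true  ∷ cs) w =
  trans (f⊕ _ _) (cong (_ ⊕_) (additive-combination f∅ f⊕ cs (w ∘ suc)))
additive-combination f∅ f⊕ (false ∷ cs) w =
  trans (f⊕ _ _) (cong₂ _⊕_ f∅ (additive-combination f∅ f⊕ cs (w ∘ suc)))

combination-basis : ∀ (s : Vec Bool n) → combination s ⁅_⁆ ≡ s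
combination-basis []       = refl
combination-basis (c ∷ cs) = begin
  scale c ⁅ zero ⁆ ⊕ combination cs (⁅_⁆ ∘ suc)
    ≡⟨ cong (scale c ⁅ zero ⁆ ⊕_) (sym (additive-combination {f = false ∷_} refl (λ _ _ → refl) cs ⁅_⁆)) ⟩
  scale c ⁅ zero ⁆ ⊕ (false ∷ combination cs ⁅_⁆)
    ≡⟨ cong (λ v → scale c ⁅ zero ⁆ ⊕ (false ∷ v)) (combination-basis cs) ⟩
  scale c ⁅ zero ⁆ ⊕ (false ∷ cs)
    ≡⟨ shift c ⟩
  c ∷ cs ∎
  where
  open ≡-Reasoning
  shift : ∀ c → scale c ⁅ zero ⁆ ⊕ (false ∷ cs) ≡ c ∷ cs
  shift true  = cong (true ∷_) (⊕-identityˡ cs)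
  shift false = cong (false ∷_) (⊕-identityˡ cs)

parity : Vec Bool n → Bool
parity []       = false
parity (b ∷ bs) = b xor parity bs

parity-⊕ : ∀ (a b : Vec Bool n) → parity (a ⊕ b) ≡ parity a xor parity b
parity-⊕ []       []       = refl
parity-⊕ (a ∷ as) (b ∷ bs) =
  trans (cong ((a xor b) xor_) (parity-⊕ as bs)) (xor-interchange a b (parity as) (parity bs))

parity-∅ : parity (∅ {n}) ≡ false
parity-∅ {zero}  = refl
parity-∅ {suc n} = parity-∅ {n}

parity-⁅⁆ : ∀ (p : Fin n) → parity ⁅ p ⁆ ≡ true
parity-⁅⁆ {suc n} zero = cong (true xor_) (parity-∅ {n})
parity-⁅⁆ (suc p) = parity-⁅⁆ p

parity-pair≢parity-triple : ∀ (a b c d e : Fin n) → ⁅ a ⁆ ⊕ ⁅ b ⁆ ≢ ⁅ c ⁆ ⊕ ⁅ d ⁆ ⊕ ⁅ e ⁆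
parity-pair≢parity-triple a b c d e eq = false≢true (begin
  false                                   ≡⟨ cong₂ _xor_ (parity-⁅⁆ a) (parity-⁅⁆ b) ⟨
  parity ⁅ a ⁆ xor parity ⁅ b ⁆           ≡⟨ parity-⊕ ⁅ a ⁆ ⁅ b ⁆ ⟨
  parity (⁅ a ⁆ ⊕ ⁅ b ⁆)                  ≡⟨ cong parity eq ⟩
  parity (⁅ c ⁆ ⊕ ⁅ d ⁆ ⊕ ⁅ e ⁆)           ≡⟨ parity-⊕ (⁅ c ⁆ ⊕ ⁅ d ⁆) ⁅ e ⁆ ⟩
  parity (⁅ c ⁆ ⊕ ⁅ d ⁆) xor parity ⁅ e ⁆ ≡⟨ cong₂ _xor_ (trans (parity-⊕ ⁅ c ⁆ ⁅ d ⁆) (cong₂ _xor_ (parity-⁅⁆ c) (parity-⁅⁆ d))) (parity-⁅⁆ e) ⟩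
  true                                    ∎)
  where
  open ≡-Reasoning
  false≢true : false ≢ true
  false≢true ()

pair-unique : ∀ {v z : Fin n} (a b : Fin n) → v ≢ z → ⁅ v ⁆ ⊕ ⁅ z ⁆ ≡ ⁅ a ⁆ ⊕ ⁅ b ⁆ → v ≡ a ⊎ v ≡ b
pair-unique {v = v} {z} a b v≢z eq = member (does (v ≟ a)) (does (v ≟ b)) refl refl (begin
  true                                  ≡⟨ cong₂ _xor_ (lookup-⁅⁆-self v) (lookup-⁅⁆-other z v (v≢z ∘ sym)) ⟨
  lookup ⁅ v ⁆ v xor lookup ⁅ z ⁆ v     ≡⟨ lookup-zipWith _xor_ v ⁅ v ⁆ ⁅ z ⁆ ⟨
  lookup (⁅ v ⁆ ⊕ ⁅ z ⁆) v              ≡⟨ cong (λ u → lookup u v) eq ⟩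
  lookup (⁅ a ⁆ ⊕ ⁅ b ⁆) v              ≡⟨ lookup-zipWith _xor_ v ⁅ a ⁆ ⁅ b ⁆ ⟩
  lookup ⁅ a ⁆ v xor lookup ⁅ b ⁆ v     ≡⟨ cong₂ _xor_ (lookup-⁅⁆ a v) (lookup-⁅⁆ b v) ⟩
  does (v ≟ a) xor does (v ≟ b)       ∎)
  where
  open ≡-Reasoning
  member : ∀ s t → does (v ≟ a) ≡ s → does (v ≟ b) ≡ t → true ≡ s xor t → v ≡ a ⊎ v ≡ b
  member true  _ s≡ _ _ = inj₁ (does≡true⇒ (v ≟ a) s≡)
  member false true _ t≡ _ = inj₂ (does≡true⇒ (v ≟ b) t≡)
  member false false _ _ ()

-- Forced vertices and OLD sets

module _ {n : ℕ} (D : Digraph n) where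

  SoleInNeighbour : Fin n → Fin n → Set
  SoleInNeighbour p y = ∀ w → D w y ⇔ (w ≡ p)

  Forced : Fin n → Set
  Forced p = (∃[ y ] SoleInNeighbour p y) ⊎ LocationForced D p

  SymDiffSingleton-comm : ∀ {y z p} → SymDiffSingleton D y z p → SymDiffSingleton D z y p
  SymDiffSingleton-comm sds w = sds w ⇔-∘ mk⇔ ⊖-comm ⊖-comm

  SymDiffSingleton⇒≢ : ∀ {y z p} → SymDiffSingleton D y z p → y ≢ z
  SymDiffSingleton⇒≢ {p = p} sds refl = ⇔⇒¬⊖ (⇔-id _) (from (sds p) refl)

  IsOLD-mono : ∀ {S T} → S ⊆ T → IsOLD D S → IsOLD D T
  IsOLD-mono S⊆T (dominating , separating) =
    (λ v → let u , u∈S , Duv = dominating v in u , S⊆T u∈S , Duv) ,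
    (λ u v u≢v → let w , w∈S , sep = separating u v u≢v in w , S⊆T w∈S , sep)

  forced∈OLD : ∀ {S p} → IsOLD D S → Forced p → p ∈ S
  forced∈OLD {S} (dominating , _) (inj₁ (y , sole))
    with u , u∈S , Duy ← dominating y = subst (_∈ S) (to (sole u) Duy) u∈S
  forced∈OLD {S} (_ , separating) (inj₂ (y , z , y≢z , sds))
    with w , w∈S , sep ← separating y z y≢z = subst (_∈ S) (to (sds w) sep) w∈S

  allForced⇒γOL≡n : IsOLD D ⊤ → (∀ p → Forced p) → γOL≡ D n
  allForced⇒γOL≡n ⊤-OLD forced =
    (⊤ , ⊤-OLD , ∣⊤∣≡n n) ,
    λ S S-OLD → subst (_≤ ∣ S ∣) (∣⊤∣≡n n) (p⊆q⇒∣p∣≤∣q∣ {p = ⊤} (λ {p} _ → forced∈OLD S-OLD (forced p)))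

  symDiffSingleton-split : ∀ {y z p} x → (∀ w → w ≢ x → InSymDiff D y z w ⇔ (w ≡ p)) →
                           (InSymDiff D y z x ⇔ (x ≡ p)) → SymDiffSingleton D y z p
  symDiffSingleton-split x off at w with w ≟ x
  ... | yes refl = at
  ... | no  w≢x  = off w w≢x

symDiffSingleton-transfer : ∀ {n} {E F : Digraph n} {x y z p} → p ≢ x →
  (∀ {w} → w ≢ x → InSymDiff F y z w ⇔ InSymDiff E y z w) → (F x y ⇔ F x z) →
  SymDiffSingleton E y z p → SymDiffSingleton F y z p
symDiffSingleton-transfer {F = F} {x} p≢x off same sds =
  symDiffSingleton-split F x (λ w w≢x → sds w ⇔-∘ off w≢x) (¬⇒⇔ (⇔⇒¬⊖ same) (p≢x ∘ sym))

module Decidable {n : ℕ} (D : Digraph n) (D? : ∀ u v → Dec (D u v)) where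

  InSymDiff? : ∀ u v w → Dec (InSymDiff D u v w)
  InSymDiff? u v w = D? w u ⊖? D? w v

  SymDiffSingleton-off : ∀ {y z p w} → SymDiffSingleton D y z p → w ≢ p → D w y ⇔ D w z
  SymDiffSingleton-off {y} {z} {w = w} sds w≢p with D? w y | D? w z
  ... | yes Dwy | yes Dwz = mk⇔ (λ _ → Dwz) (λ _ → Dwy)
  ... | no ¬Dwy | no ¬Dwz = ¬⇒⇔ ¬Dwy ¬Dwz
  ... | yes Dwy | no ¬Dwz = contradiction (to (sds w) (inj₁ (Dwy , ¬Dwz))) w≢p
  ... | no ¬Dwy | yes Dwz = contradiction (to (sds w) (inj₂ (Dwz , ¬Dwy))) w≢p

  SoleInNeighbour? : ∀ p y → Dec (SoleInNeighbour D p y)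
  SoleInNeighbour? p y = all? (λ w → D? w y ⇔? (w ≟ p))

  SymDiffSingleton? : ∀ y z p → Dec (SymDiffSingleton D y z p)
  SymDiffSingleton? y z p = all? (λ w → InSymDiff? y z w ⇔? (w ≟ p))

  ForcingArc? : ∀ x y → Dec (ForcingArc D x y)
  ForcingArc? x y = D? x y ×-dec (SoleInNeighbour? x y ⊎-dec any? (λ z → SymDiffSingleton? y z x))

  Forced? : ∀ p → Dec (Forced D p)
  Forced? p = any? (λ y → SoleInNeighbour? p y)
          ⊎-dec any? (λ y → any? (λ z → ¬? (y ≟ z) ×-dec SymDiffSingleton? y z p))

  ¬forced⇒IsOLD-∁ : ∀ {p} → IsOLD D ⊤ → ¬ Forced D p → IsOLD D (∁ ⁅ p ⁆)
  ¬forced⇒IsOLD-∁ {p} (dominating , separating) ¬forced = dominating′ , separating′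
    where
    ∈∁⁅p⁆ : ∀ {w} → w ≢ p → w ∈ ∁ ⁅ p ⁆
    ∈∁⁅p⁆ w≢p = x∉p⇒x∈∁p (w≢p ∘ x∈⁅y⁆⇒x≡y p)
    dominating′ : ∀ v → ∃[ u ] (u ∈ ∁ ⁅ p ⁆ × D u v)
    dominating′ v with other-or-only (λ w → D? w v) (let u , _ , Duv = dominating v in u , Duv) p
    ... | inj₁ (u , u≢p , Duv) = u , ∈∁⁅p⁆ u≢p , Duv
    ... | inj₂ sole            = contradiction (inj₁ (v , sole)) ¬forced
    separating′ : ∀ u v → u ≢ v → ∃[ w ] (w ∈ ∁ ⁅ p ⁆ × InSymDiff D u v w)
    separating′ u v u≢v with other-or-only (InSymDiff? u v) (let w , _ , sep = separating u v u≢v in w , sep) p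
    ... | inj₁ (w , w≢p , sep) = w , ∈∁⁅p⁆ w≢p , sep
    ... | inj₂ sds             = contradiction (inj₂ (u , v , u≢v , sds)) ¬forced

  γOL≡n⇒forced : γOL≡ D n → ∀ p → Forced D p
  γOL≡n⇒forced ((S , S-OLD , _) , minimal) p = decidable-stable (Forced? p) λ ¬forced →
    <⇒≱ ∣∁⁅p⁆∣<n (minimal _ (¬forced⇒IsOLD-∁ (IsOLD-mono D ⊆⊤ S-OLD) ¬forced))
    where
    ∣∁⁅p⁆∣<n : ∣ ∁ ⁅ p ⁆ ∣ < n
    ∣∁⁅p⁆∣<n = subst (∣ ∁ ⁅ p ⁆ ∣ <_) (∣⊤∣≡n n) (p⊂q⇒∣p∣<∣q∣ (⊆⊤ , p , ∈⊤ , λ p∈∁ → x∈∁p⇒x∉p p∈∁ (x∈⁅x⁆ p)))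

module Deletion {n : ℕ} (D : Digraph n) (D? : ∀ u v → Dec (D u v)) (x : Fin n) where

  open Decidable D D?

  D′ : Digraph n
  D′ = deleteNonForcingFrom D x

  D′-off : ∀ {w y} → w ≢ x → D′ w y ⇔ D w y
  D′-off w≢x = mk⇔ proj₁ (λ Dwy → Dwy , λ w≡x → contradiction w≡x w≢x)

  InSymDiff-off : ∀ {w y z} → w ≢ x → InSymDiff D′ y z w ⇔ InSymDiff D y z w
  InSymDiff-off w≢x = ⊖-cong (D′-off w≢x) (D′-off w≢x)

  forcing⇒D′ : ∀ {w y} → ForcingArc D w y → D′ w y
  forcing⇒D′ F = proj₁ F , λ _ → F

  D′⇒forcing : ∀ {y} → D′ x y → ForcingArc D x y
  D′⇒forcing D′xy = proj₂ D′xy refl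

  sole-D′ : ∀ {p y} → D′ p y → SoleInNeighbour D p y → SoleInNeighbour D′ p y
  sole-D′ D′py sole w = mk⇔ (to (sole w) ∘ proj₁) (λ { refl → D′py })

  symDiffAtTail-D′ : ∀ {y z} → SymDiffSingleton D y z x → InSymDiff D y z x → InSymDiff D′ y z x
  symDiffAtTail-D′ {y} {z} sds (inj₁ (Dxy , ¬Dxz)) =
    inj₁ (forcing⇒D′ (Dxy , inj₂ (z , sds)) , ¬Dxz ∘ proj₁)
  symDiffAtTail-D′ {y} {z} sds (inj₂ (Dxz , ¬Dxy)) =
    inj₂ (forcing⇒D′ (Dxz , inj₂ (y , SymDiffSingleton-comm D sds)) , ¬Dxy ∘ proj₁)

  IsOLD-⊤-D′ : IsOLD D ⊤ → IsOLD D′ ⊤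
  IsOLD-⊤-D′ (dominating , separating) = dominating′ , separating′
    where
    dominating′ : ∀ y → ∃[ u ] (u ∈ ⊤ × D′ u y)
    dominating′ y with other-or-only (λ w → D? w y) (let u , _ , Duy = dominating y in u , Duy) x
    ... | inj₁ (u , u≢x , Duy) = u , ∈⊤ , from (D′-off u≢x) Duy
    ... | inj₂ sole            = x , ∈⊤ , forcing⇒D′ (from (sole x) refl , inj₁ sole)
    separating′ : ∀ u v → u ≢ v → ∃[ w ] (w ∈ ⊤ × InSymDiff D′ u v w)
    separating′ u v u≢v with other-or-only (InSymDiff? u v) (let w , _ , sep = separating u v u≢v in w , sep) x
    ... | inj₁ (w , w≢x , sep) = w , ∈⊤ , from (InSymDiff-off w≢x) sep
    ... | inj₂ sds             = x , ∈⊤ , symDiffAtTail-D′ sds (from (sds x) refl)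

  sole-D′-beside : ∀ {y z p} → p ≢ x → SymDiffSingleton D y z p → ¬ ForcingArc D x y →
                   SoleInNeighbour D x z → SoleInNeighbour D′ p y
  sole-D′-beside {y} {z} {p} p≢x sds ¬Fxy sole-z w = mk⇔ (only-p w) (λ { refl → D′py })
    where
    D′py : D′ p y
    D′py with from (sds p) refl
    ... | inj₁ (Dpy , _) = from (D′-off p≢x) Dpy
    ... | inj₂ (Dpz , _) = contradiction (to (sole-z p) Dpz) p≢x
    only-p : ∀ w → D′ w y → w ≡ p
    only-p w D′wy with w ≟ x
    ... | yes refl = contradiction (D′⇒forcing D′wy) ¬Fxy
    ... | no  w≢x  = to (sds w) (inj₁ (proj₁ D′wy , w≢x ∘ to (sole-z w)))

  locationForced-D′-oneForcing : ∀ {y z p} → p ≢ x → SymDiffSingleton D y z p →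
    ¬ ForcingArc D x y → ForcingArc D x z → Forced D′ p
  locationForced-D′-oneForcing {y} p≢x sds ¬Fxy (_ , inj₁ sole-z) = inj₁ (y , sole-D′-beside p≢x sds ¬Fxy sole-z)
  locationForced-D′-oneForcing {y} {z} {p} p≢x sds ¬Fxy (Dxz , inj₂ (w₀ , sds-z)) =
    inj₂ (y , w₀ , SymDiffSingleton⇒≢ D′ sds′ , sds′)
    where
    ¬Dxw₀ : ¬ D x w₀
    ¬Dxw₀ with from (sds-z x) refl
    ... | inj₁ (_ , ¬Dxw₀) = ¬Dxw₀
    ... | inj₂ (_ , ¬Dxz)  = contradiction Dxz ¬Dxz
    -- w₀ takes over the role of z: N⁻(w₀) and N⁻(z) differ only at x.
    sds′ : SymDiffSingleton D′ y w₀ p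
    sds′ = symDiffSingleton-split D′ x
      (λ w w≢x → sds w ⇔-∘ ⊖-cong (D′-off w≢x) (⇔-sym (SymDiffSingleton-off sds-z w≢x) ⇔-∘ D′-off w≢x))
      (¬⇒⇔ (⇔⇒¬⊖ (¬⇒⇔ (¬Fxy ∘ D′⇒forcing) (¬Dxw₀ ∘ proj₁))) (p≢x ∘ sym))

  locationForced-D′ : ∀ {y z p} → y ≢ z → SymDiffSingleton D y z p → Forced D′ p
  locationForced-D′ {y} {z} {p} y≢z sds with p ≟ x
  ... | yes refl = inj₂ (y , z , y≢z , symDiffSingleton-split D′ x
                     (λ w w≢x → sds w ⇔-∘ InSymDiff-off w≢x)
                     (mk⇔ (λ _ → refl) (λ _ → symDiffAtTail-D′ sds (from (sds x) refl))))
  ... | no p≢x with ForcingArc? x y | ForcingArc? x z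
  ...   | yes Fxy | yes Fxz = inj₂ (y , z , y≢z , symDiffSingleton-transfer {E = D} {F = D′} p≢x InSymDiff-off
                                  (mk⇔ (λ _ → forcing⇒D′ Fxz) (λ _ → forcing⇒D′ Fxy)) sds)
  ...   | no ¬Fxy | no ¬Fxz = inj₂ (y , z , y≢z , symDiffSingleton-transfer {E = D} {F = D′} p≢x InSymDiff-off
                                  (¬⇒⇔ (¬Fxy ∘ D′⇒forcing) (¬Fxz ∘ D′⇒forcing)) sds)
  ...   | no ¬Fxy | yes Fxz = locationForced-D′-oneForcing p≢x sds ¬Fxy Fxz
  ...   | yes Fxy | no ¬Fxz = locationForced-D′-oneForcing p≢x (SymDiffSingleton-comm D sds) ¬Fxz Fxy

  forced-D′ : ∀ {p} → Forced D p → Forced D′ p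
  forced-D′ (inj₁ (y , sole))           = inj₁ (y , sole-D′ (forcing⇒D′ (from (sole _) refl , inj₁ sole)) sole)
  forced-D′ (inj₂ (y , z , y≢z , sds)) = locationForced-D′ y≢z sds

-- In-neighbourhoods as vectors over GF(2)

module Independence {n : ℕ} (D : Digraph n) (D? : ∀ u v → Dec (D u v)) (forced : ∀ p → Forced D p) where

  open Decidable D D?

  inVec : Fin n → Vec Bool n
  inVec y = indicator (λ w → D? w y)

  inSum : Vec Bool n → Vec Bool n
  inSum T = combination T inVec

  inVec-sole : ∀ {p y} → SoleInNeighbour D p y → inVec y ≡ ⁅ p ⁆
  inVec-sole {p} {y} sole = trans (indicator-cong (λ w → D? w y) (_≟ p) sole) (sym (⁅⁆-indicator p))

  inVec-⊕ : ∀ {y z} {P : Fin n → Set} (P? : ∀ w → Dec (P w)) → (∀ w → InSymDiff D y z w ⇔ P w) →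
            inVec y ⊕ inVec z ≡ indicator P?
  inVec-⊕ {y} {z} P? same = trans (indicator-⊕ (λ w → D? w y) (λ w → D? w z)) (indicator-cong (λ w → D? w y ⊖? D? w z) P? same)

  inVec-symDiff : ∀ {y z p} → SymDiffSingleton D y z p → inVec y ⊕ inVec z ≡ ⁅ p ⁆
  inVec-symDiff {p = p} sds = trans (inVec-⊕ (_≟ p) sds) (sym (⁅⁆-indicator p))

  inSum-⁅⁆ : ∀ y → inSum ⁅ y ⁆ ≡ inVec y
  inSum-⁅⁆ y = combination-⁅⁆ y inVec

  inSum-⁅⁆⊕⁅⁆ : ∀ y z → inSum (⁅ y ⁆ ⊕ ⁅ z ⁆) ≡ inVec y ⊕ inVec z
  inSum-⁅⁆⊕⁅⁆ y z = trans (combination-⊕ ⁅ y ⁆ ⁅ z ⁆ inVec) (cong₂ _⊕_ (inSum-⁅⁆ y) (inSum-⁅⁆ z))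

  preimage : ∀ {p} → Forced D p → Vec Bool n
  preimage (inj₁ (y , _))         = ⁅ y ⁆
  preimage (inj₂ (y , z , _ , _)) = ⁅ y ⁆ ⊕ ⁅ z ⁆

  inSum-preimage : ∀ {p} (f : Forced D p) → inSum (preimage f) ≡ ⁅ p ⁆
  inSum-preimage (inj₁ (y , sole))         = trans (inSum-⁅⁆ y) (inVec-sole sole)
  inSum-preimage (inj₂ (y , z , _ , sds)) = trans (inSum-⁅⁆⊕⁅⁆ y z) (inVec-symDiff sds)

  inSum-injective : Injective _≡_ _≡_ inSum
  inSum-injective = leftInverse⇒injective {f = section} (finite-leftInverse⇒rightInverse (Vec-Bool↔Fin n) {f = inSum} {g = section} inSum∘section)
    where
    section : Vec Bool n → Vec Bool n
    section t = combination t (preimage ∘ forced)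
    inSum∘section : ∀ t → inSum (section t) ≡ t
    inSum∘section t = begin
      inSum (combination t (preimage ∘ forced))        ≡⟨ additive-combination (combination-∅ inVec) (λ a b → combination-⊕ a b inVec) t _ ⟩
      combination t (inSum ∘ preimage ∘ forced)        ≡⟨ combination-cong t (inSum-preimage ∘ forced) ⟩
      combination t ⁅_⁆                                ≡⟨ combination-basis t ⟩
      t                                               ∎
      where open ≡-Reasoning

  symDiff≡pair⇒sole : ∀ {u x y₀ v z} → u ≢ x → D u v → SoleInNeighbour D x y₀ →
    (∀ w → w ≢ x → InSymDiff D v z w ⇔ (w ≡ u)) → InSymDiff D v z x → SoleInNeighbour D u v
  symDiff≡pair⇒sole {u} {x} {y₀} {v} {z} u≢x Duv sole-y₀ off at = by-cases (forced u)
    where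
    open ≡-Reasoning
    v≢z : v ≢ z
    v≢z refl = ⇔⇒¬⊖ (⇔-id _) at
    pair : ∀ w → InSymDiff D v z w ⇔ ((w ≡ u) ⊖ (w ≡ x))
    pair w with w ≟ x
    ... | yes refl = mk⇔ (λ _ → inj₂ (refl , u≢x ∘ sym)) (λ _ → at)
    ... | no  w≢x  = mk⇔ (λ sep → inj₁ (to (off w w≢x) sep , w≢x))
                         (λ { (inj₁ (w≡u , _)) → from (off w w≢x) w≡u ; (inj₂ (w≡x , _)) → contradiction w≡x w≢x })
    inSum-vz : inSum (⁅ v ⁆ ⊕ ⁅ z ⁆) ≡ ⁅ u ⁆ ⊕ inSum ⁅ y₀ ⁆
    inSum-vz = begin
      inSum (⁅ v ⁆ ⊕ ⁅ z ⁆)                        ≡⟨ inSum-⁅⁆⊕⁅⁆ v z ⟩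
      inVec v ⊕ inVec z                            ≡⟨ inVec-⊕ (λ w → (w ≟ u) ⊖? (w ≟ x)) pair ⟩
      indicator (λ w → (w ≟ u) ⊖? (w ≟ x))         ≡⟨ indicator-⊕ (_≟ u) (_≟ x) ⟨
      indicator (_≟ u) ⊕ indicator (_≟ x)          ≡⟨ cong₂ _⊕_ (⁅⁆-indicator u) (⁅⁆-indicator x) ⟨
      ⁅ u ⁆ ⊕ ⁅ x ⁆                                ≡⟨ cong (⁅ u ⁆ ⊕_) (trans (inSum-⁅⁆ y₀) (inVec-sole sole-y₀)) ⟨
      ⁅ u ⁆ ⊕ inSum ⁅ y₀ ⁆                         ∎
    by-cases : Forced D u → SoleInNeighbour D u v
    by-cases (inj₁ (a , sole-a)) = by-pair (pair-unique a y₀ v≢z (inSum-injective (begin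
      inSum (⁅ v ⁆ ⊕ ⁅ z ⁆)      ≡⟨ inSum-vz ⟩
      ⁅ u ⁆ ⊕ inSum ⁅ y₀ ⁆       ≡⟨ cong (_⊕ inSum ⁅ y₀ ⁆) (trans (inSum-⁅⁆ a) (inVec-sole sole-a)) ⟨
      inSum ⁅ a ⁆ ⊕ inSum ⁅ y₀ ⁆ ≡⟨ combination-⊕ ⁅ a ⁆ ⁅ y₀ ⁆ inVec ⟨
      inSum (⁅ a ⁆ ⊕ ⁅ y₀ ⁆)     ∎)))
      where
      by-pair : v ≡ a ⊎ v ≡ y₀ → SoleInNeighbour D u v
      by-pair (inj₁ refl) = sole-a
      by-pair (inj₂ refl) = contradiction (to (sole-y₀ u) Duv) u≢x
    by-cases (inj₂ (a , b , _ , sds)) = contradiction (inSum-injective (begin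
      inSum (⁅ v ⁆ ⊕ ⁅ z ⁆)                  ≡⟨ inSum-vz ⟩
      ⁅ u ⁆ ⊕ inSum ⁅ y₀ ⁆                   ≡⟨ cong (_⊕ inSum ⁅ y₀ ⁆) (trans (inSum-⁅⁆⊕⁅⁆ a b) (inVec-symDiff sds)) ⟨
      inSum (⁅ a ⁆ ⊕ ⁅ b ⁆) ⊕ inSum ⁅ y₀ ⁆   ≡⟨ combination-⊕ (⁅ a ⁆ ⊕ ⁅ b ⁆) ⁅ y₀ ⁆ inVec ⟨
      inSum (⁅ a ⁆ ⊕ ⁅ b ⁆ ⊕ ⁅ y₀ ⁆)          ∎))
      (parity-pair≢parity-triple v z a b y₀)

module ForcingArcs {n : ℕ} (D : Digraph n) (D? : ∀ u v → Dec (D u v)) (forced : ∀ p → Forced D p)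
                   (x : Fin n) (x-notLocationForced : ¬ LocationForced D x) where

  open Decidable D D?
  open Deletion D D? x
  open Independence D D? forced

  forcingFromTail⇒sole : ∀ {v} → ForcingArc D x v → SoleInNeighbour D x v
  forcingFromTail⇒sole (_ , inj₁ sole) = sole
  forcingFromTail⇒sole {v} (_ , inj₂ (z , sds)) =
    contradiction (v , z , SymDiffSingleton⇒≢ D sds , sds) x-notLocationForced

  tailSole : ∃[ y₀ ] SoleInNeighbour D x y₀
  tailSole with forced x
  ... | inj₁ sole = sole
  ... | inj₂ locationForced = contradiction locationForced x-notLocationForced

  y₀ : Fin n
  y₀ = proj₁ tailSole

  sole-y₀ : SoleInNeighbour D x y₀
  sole-y₀ = proj₂ tailSole

  ¬forcingFromTail : ∀ {u v} → u ≢ x → D u v → ¬ ForcingArc D x v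
  ¬forcingFromTail u≢x Duv Fxv = u≢x (to (forcingFromTail⇒sole Fxv _) Duv)

  forcing⇒forcing-D′ : ∀ {u v} → ForcingArc D u v → ForcingArc D′ u v
  forcing⇒forcing-D′ F@(_ , inj₁ sole) = forcing⇒D′ F , inj₁ (sole-D′ (forcing⇒D′ F) sole)
  forcing⇒forcing-D′ {u} {v} F@(Duv , inj₂ (z , sds)) with u ≟ x
  ... | yes refl = forcing⇒D′ F , inj₁ (sole-D′ (forcing⇒D′ F) (forcingFromTail⇒sole F))
  ... | no u≢x with ForcingArc? x z
  ...   | yes Fxz = forcing⇒D′ F , inj₁ (sole-D′-beside u≢x sds (¬forcingFromTail u≢x Duv) (forcingFromTail⇒sole Fxz))
  ...   | no ¬Fxz = forcing⇒D′ F , inj₂ (z , symDiffSingleton-transfer {E = D} {F = D′} u≢x InSymDiff-off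
                      (¬⇒⇔ (¬forcingFromTail u≢x Duv ∘ D′⇒forcing) (¬Fxz ∘ D′⇒forcing)) sds)

  sole-D′⇒sole : ∀ {u v} → u ≢ x → ¬ D x v → SoleInNeighbour D′ u v → SoleInNeighbour D u v
  sole-D′⇒sole {u} {v} u≢x ¬Dxv sole′ w with w ≟ x
  ... | yes refl = ¬⇒⇔ ¬Dxv (u≢x ∘ sym)
  ... | no  w≢x  = sole′ w ⇔-∘ ⇔-sym (D′-off w≢x)

  sole-D′⇒symDiff-y₀ : ∀ {u v} → u ≢ x → D u v → D x v → SoleInNeighbour D′ u v → SymDiffSingleton D v y₀ u
  sole-D′⇒symDiff-y₀ {u} {v} u≢x Duv Dxv sole′ = symDiffSingleton-split D x off
    (¬⇒⇔ (⇔⇒¬⊖ (mk⇔ (λ _ → from (sole-y₀ x) refl) (λ _ → Dxv))) (u≢x ∘ sym))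
    where
    off : ∀ w → w ≢ x → InSymDiff D v y₀ w ⇔ (w ≡ u)
    off w w≢x = mk⇔ (λ { (inj₁ (Dwv , _)) → to (sole′ w) (from (D′-off w≢x) Dwv)
                       ; (inj₂ (Dwy₀ , _)) → contradiction (to (sole-y₀ w) Dwy₀) w≢x })
                    (λ { refl → inj₁ (Duv , u≢x ∘ to (sole-y₀ u)) })

  forcing-D′⇒forcing : ∀ {u v} → ForcingArc D′ u v → ForcingArc D u v
  forcing-D′⇒forcing {u} {v} (D′uv , kind) with u ≟ x
  ... | yes refl = D′⇒forcing D′uv
  ... | no  u≢x  = Duv , reflect kind
    where
    Duv : D u v
    Duv = proj₁ D′uv
    reflect : SoleInNeighbour D′ u v ⊎ ∃[ z ] SymDiffSingleton D′ v z u →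
              SoleInNeighbour D u v ⊎ ∃[ z ] SymDiffSingleton D v z u
    reflect (inj₁ sole′) with D? x v
    ... | yes Dxv = inj₂ (y₀ , sole-D′⇒symDiff-y₀ u≢x Duv Dxv sole′)
    ... | no ¬Dxv = inj₁ (sole-D′⇒sole u≢x ¬Dxv sole′)
    reflect (inj₂ (z , sds′)) with D? x v ⊖? D? x z
    -- N⁻(v) ⊖ N⁻(z) = {u, x} in D: the case that needs linear independence.
    ... | yes at = inj₁ (symDiff≡pair⇒sole u≢x Duv sole-y₀ (λ w w≢x → sds′ w ⇔-∘ ⇔-sym (InSymDiff-off w≢x)) at)
    ... | no ¬at = inj₂ (z , symDiffSingleton-split D x (λ w w≢x → sds′ w ⇔-∘ ⇔-sym (InSymDiff-off w≢x))
                                                      (¬⇒⇔ ¬at (u≢x ∘ sym)))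

lemma2p7 : (n : ℕ) (D : Digraph n) → (∀ u v → Dec (D u v)) →
    Locatable D → γOL≡ D n → (x : Fin n) →
    (Locatable (deleteNonForcingFrom D x) × γOL≡ (deleteNonForcingFrom D x) n)
    × (¬ LocationForced D x →
       ∀ u v → ForcingArc D u v ⇔ ForcingArc (deleteNonForcingFrom D x) u v)
lemma2p7 n D D? (S , S-OLD) γ x =
  ((⊤ , ⊤-OLD′) , allForced⇒γOL≡n D′ ⊤-OLD′ (forced-D′ ∘ forced)) ,
  λ x-notLocationForced u v → let open ForcingArcs D D? forced x x-notLocationForced
                              in mk⇔ forcing⇒forcing-D′ forcing-D′⇒forcing
  where
  open Deletion D D? x
  forced : ∀ p → Forced D p
  forced = Decidable.γOL≡n⇒forced D D? γ
  ⊤-OLD′ : IsOLD D′ ⊤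
  ⊤-OLD′ = IsOLD-⊤-D′ (IsOLD-mono D ⊆⊤ S-OLD)
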